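{- Let $w\geq 3$ and let $B=\{(1,0,0,0,0),(1,1,0,0,0),(1,0,1,0,0),(0,0,0,1,1),(0,1,1,1,1),(0,0,1,1,1),(0,1,0,1,1),(1,1,1,0,0)\}$. Define $C_1=\{(x_1,\dots,x_{2w})\in J(2w,w) : (x_1,x_2,x_3,x_4,x_5)\in B\}$ and $C_2=V(J(2w,w))\setminus C_1$. Then $(C_1,C_2)$ is an equitable partition of $J(2w,w)$ with quotient matrix $\begin{pmatrix} w^2-3w+2 & 3w-2\\ w & w^2-w\end{pmatrix}$.
   Context: The Johnson graph $J(n,w)$ has as vertices the binary vectors of length $n$ with exactly $w$ ones; two vertices are adjacent if they have exactly $w-1$ common ones. A partition $(C_1,C_2)$ of the vertex set of a graph is equitable with quotient matrix $S=(s_{ij})_{i,j\in\{1,2\}}$ if every vertex of $C_i$ has exactly $s_{ij}$ neighbours in $C_j$. -}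

module Defs where

open import Data.Bool using (Bool; true; false; _∧_; not; if_then_else_)
open import Data.Nat using (ℕ; zero; suc; _+_; _∸_; _≟_)
open import Data.List as List using (List; []; _∷_; length; filter; map; _++_; take)
open import Data.Vec as Vec using (Vec; []; _∷_; toList)
open import Data.Product using (_×_; _,_)
open import Relation.Binary.PropositionalEquality using (_≡_)
open import Relation.Nullary.Decidable using (⌊_⌋)
open import Data.Bool.ListAction using (any)

-- binary vectors of length n, represented as Vec Bool n (true = 1)

weight : ∀ {n} → Vec Bool n → ℕ
weight []            = 0
weight (true  ∷ xs)  = suc (weight xs)
weight (false ∷ xs)  = weight xs

common : ∀ {n} → Vec Bool n → Vec Bool n → ℕ
common []           []           = 0
common (true ∷ xs)  (true ∷ ys)  = suc (common xs ys)
common (_ ∷ xs)     (_ ∷ ys)     = common xs ys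

allVecs : (n : ℕ) → List (Vec Bool n)
allVecs zero    = [] ∷ []
allVecs (suc n) = map (false ∷_) (allVecs n) ++ map (true ∷_) (allVecs n)

johnsonVertices : (n w : ℕ) → List (Vec Bool n)
johnsonVertices n w = filter (λ x → weight x ≟ w) (allVecs n)

johnsonAdj : ∀ {n} (w : ℕ) → Vec Bool n → Vec Bool n → Bool
johnsonAdj w x y = ⌊ common x y ≟ w ∸ 1 ⌋

neighboursIn : (n w : ℕ) → (Vec Bool n → Bool) → Vec Bool n → ℕ
neighboursIn n w C x =
  length (filter (λ y → (johnsonAdj w x y ∧ C y) Data.Bool.≟ true) (johnsonVertices n w))

-- the two-cell partition (C₁ , C₂) with C₁ = { x | C x ≡ true }, C₂ = complement
-- (within the vertex set) is equitable with quotient matrix (s11 s12 ; s21 s22)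
IsEquitable2 : (n w : ℕ) → (C : Vec Bool n → Bool) → (s11 s12 s21 s22 : ℕ) → Set
IsEquitable2 n w C s11 s12 s21 s22 =
  ∀ (x : Vec Bool n) → weight x ≡ w →
    (C x ≡ true  → neighboursIn n w C x ≡ s11 × neighboursIn n w (λ y → not (C y)) x ≡ s12) ×
    (C x ≡ false → neighboursIn n w C x ≡ s21 × neighboursIn n w (λ y → not (C y)) x ≡ s22)

B : List (List Bool)
B = (true ∷ false ∷ false ∷ false ∷ false ∷ [])
  ∷ (true ∷ true ∷ false ∷ false ∷ false ∷ [])
  ∷ (true ∷ false ∷ true ∷ false ∷ false ∷ [])
  ∷ (false ∷ false ∷ false ∷ true ∷ true ∷ [])
  ∷ (false ∷ true ∷ true ∷ true ∷ true ∷ [])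
  ∷ (false ∷ false ∷ true ∷ true ∷ true ∷ [])
  ∷ (false ∷ true ∷ false ∷ true ∷ true ∷ [])
  ∷ (true ∷ true ∷ true ∷ false ∷ false ∷ [])
  ∷ []

eqList : List Bool → List Bool → Bool
eqList []       []       = true
eqList (a ∷ as) (b ∷ bs) = ⌊ a Data.Bool.≟ b ⌋ ∧ eqList as bs
eqList _        _        = false

memB : List Bool → Bool
memB l = any (eqList l) B

inC1 : ∀ {n} → Vec Bool n → Bool
inC1 x = memB (take 5 (toList x))

module Submission where

-- Write a vertex of J(2w,w) as x = p ++ r with p its first five coordinates, and a
-- candidate neighbour as y = q ++ s.  Adjacency means that y arises from x by turning
-- one 1 into a 0 and one 0 into a 1.  If the prefix has already lost e ones and
-- gained f ones (e = excess p q, f = excess q p), the number of tails s completing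
-- the swap is pick a e * pick z f, where r has a ones and z zeros and pick n k is the
-- number of ways to choose 1 ∸ k of n objects (0 if k ≥ 2) (tailCount-formula).
-- Summing over the prefixes q admitted by a cell expresses every neighbour count of
-- x as a function of p, a and z alone (neighbours-by-prefix).  For a vertex of
-- J(2w,w), a, z and w are fixed offsets, determined by the weight of p, plus one
-- common parameter t (parametrise); each count thereby becomes a quadratic
-- polynomial in t (swapPoly).  Evaluating these polynomials for all 32 prefixes p
-- shows that they are the entries of the quotient matrix, written as polynomials in
-- t (rows-agree), which gives the theorem.

open import Defs
open import Data.Bool using (Bool; true; false; _∧_; not; if_then_else_)
import Data.Bool as Bool
open import Data.Bool.Properties using (∧-comm; ∧-assoc)
open import Data.Nat using (ℕ; zero; suc; _+_; _*_; _∸_; _≤_; _≡ᵇ_; _≟_; z≤n; s≤s)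
open import Data.Nat.Properties
  using (+-suc; +-assoc; +-comm; +-identityʳ; *-identityˡ; *-distribʳ-+; *-distribˡ-+;
         +-cancelˡ-≡; +-cancelʳ-≡; suc-injective; m+n∸m≡n; m+[n∸m]≡n)
open import Data.Nat.ListAction using (sum)
open import Data.Nat.ListAction.Properties using (sum-++)
open import Data.Nat.Tactic.RingSolver using (solve-∀)
open import Data.List using (List; []; _∷_; map; foldr; length; filter)
import Data.List as List
open import Data.List.Properties using (map-++; map-∘; map-cong; ∷-injectiveˡ; ∷-injectiveʳ)
open import Data.List.Relation.Unary.All using (All; []; _∷_)
open import Data.List.Relation.Unary.All.Properties using (map⁻; ++⁻ˡ; ++⁻ʳ)
open import Data.Vec using (Vec; []; _∷_; toList) renaming (_++_ to _++ᵛ_)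
open import Data.Product using (_×_; _,_; ∃; proj₁; proj₂)
open import Function using (_∘_)
open import Relation.Binary.PropositionalEquality
  using (_≡_; refl; sym; trans; cong; cong₂; subst; module ≡-Reasoning)
open import Relation.Nullary.Decidable using (isYes≗does)

open ≡-Reasoning

count : {A : Set} → (A → Bool) → List A → ℕ
count f []       = 0
count f (x ∷ xs) = if f x then suc (count f xs) else count f xs

count-++ : {A : Set} (f : A → Bool) (xs ys : List A) →
           count f (xs List.++ ys) ≡ count f xs + count f ys
count-++ f []       ys = refl
count-++ f (x ∷ xs) ys with f x
... | true  = cong suc (count-++ f xs ys)
... | false = count-++ f xs ys

count-map : {A B : Set} (f : B → Bool) (g : A → B) (xs : List A) →
            count f (map g xs) ≡ count (f ∘ g) xs
count-map f g []       = refl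
count-map f g (x ∷ xs) = cong (λ n → if f (g x) then suc n else n) (count-map f g xs)

count-cong : {A : Set} {f g : A → Bool} → (∀ x → f x ≡ g x) → (xs : List A) →
             count f xs ≡ count g xs
count-cong h []       = refl
count-cong h (x ∷ xs) = cong₂ (λ b n → if b then suc n else n) (h x) (count-cong h xs)

count-guard : {A : Set} (b : Bool) (g : A → Bool) (xs : List A) →
              count (λ x → b ∧ g x) xs ≡ (if b then count g xs else 0)
count-guard true  g xs       = refl
count-guard false g []       = refl
count-guard false g (x ∷ xs) = count-guard false g xs

count-allVecs-suc : ∀ {n} (F : Vec Bool (suc n) → Bool) →
  count F (allVecs (suc n)) ≡ count (F ∘ (false ∷_)) (allVecs n) + count (F ∘ (true ∷_)) (allVecs n)
count-allVecs-suc {n} F =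
  trans (count-++ F (map (false ∷_) (allVecs n)) (map (true ∷_) (allVecs n)))
        (cong₂ _+_ (count-map F (false ∷_) (allVecs n)) (count-map F (true ∷_) (allVecs n)))

count-prefix : ∀ L {m} (F : Vec Bool (L + m) → Bool) →
  count F (allVecs (L + m)) ≡ sum (map (λ q → count (F ∘ (q ++ᵛ_)) (allVecs m)) (allVecs L))
count-prefix zero    F = sym (+-identityʳ _)
count-prefix (suc L) {m} F = begin
    count F (allVecs (suc L + m))
  ≡⟨ count-allVecs-suc F ⟩
    count (F ∘ (false ∷_)) (allVecs (L + m)) + count (F ∘ (true ∷_)) (allVecs (L + m))
  ≡⟨ cong₂ _+_ (count-prefix L (F ∘ (false ∷_))) (count-prefix L (F ∘ (true ∷_))) ⟩
    sum (map (g ∘ (false ∷_)) (allVecs L)) + sum (map (g ∘ (true ∷_)) (allVecs L))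
  ≡⟨ cong₂ (λ xs ys → sum xs + sum ys) (map-∘ (allVecs L)) (map-∘ (allVecs L)) ⟩
    sum (map g (map (false ∷_) (allVecs L))) + sum (map g (map (true ∷_) (allVecs L)))
  ≡⟨ sym (sum-++ (map g (map (false ∷_) (allVecs L))) _) ⟩
    sum (map g (map (false ∷_) (allVecs L)) List.++ map g (map (true ∷_) (allVecs L)))
  ≡⟨ cong sum (sym (map-++ g (map (false ∷_) (allVecs L)) _)) ⟩
    sum (map g (allVecs (suc L))) ∎
  where
  g : Vec Bool (suc L) → ℕ
  g q = count (F ∘ (q ++ᵛ_)) (allVecs m)

All-allVecs : ∀ {n} {P : Vec Bool n → Set} → All P (allVecs n) → ∀ v → P v
All-allVecs {zero}  (p ∷ []) []          = p
All-allVecs {suc n} ps       (false ∷ v) = All-allVecs (map⁻ (++⁻ˡ _ ps)) v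
All-allVecs {suc n} ps       (true ∷ v)  = All-allVecs (map⁻ (++⁻ʳ _ ps)) v

map-≡⇒All : {A B : Set} {f g : A → B} (xs : List A) → map f xs ≡ map g xs →
            All (λ x → f x ≡ g x) xs
map-≡⇒All []       _  = []
map-≡⇒All (x ∷ xs) eq = ∷-injectiveˡ eq ∷ map-≡⇒All xs (∷-injectiveʳ eq)

zeros : ∀ {n} → Vec Bool n → ℕ
zeros []          = 0
zeros (true ∷ v)  = zeros v
zeros (false ∷ v) = suc (zeros v)

weight+zeros : ∀ {n} (v : Vec Bool n) → weight v + zeros v ≡ n
weight+zeros []          = refl
weight+zeros (true ∷ v)  = cong suc (weight+zeros v)
weight+zeros (false ∷ v) = trans (+-suc (weight v) (zeros v)) (cong suc (weight+zeros v))

excess : ∀ {n} → Vec Bool n → Vec Bool n → ℕ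
excess []          []          = 0
excess (true ∷ p)  (false ∷ q) = suc (excess p q)
excess (_ ∷ p)     (_ ∷ q)     = excess p q

weight-splitˡ : ∀ {n} (p q : Vec Bool n) → weight p ≡ common p q + excess p q
weight-splitˡ []          []          = refl
weight-splitˡ (true ∷ p)  (true ∷ q)  = cong suc (weight-splitˡ p q)
weight-splitˡ (true ∷ p)  (false ∷ q) = trans (cong suc (weight-splitˡ p q)) (sym (+-suc _ _))
weight-splitˡ (false ∷ p) (_ ∷ q)     = weight-splitˡ p q

weight-splitʳ : ∀ {n} (p q : Vec Bool n) → weight q ≡ common p q + excess q p
weight-splitʳ []          []          = refl
weight-splitʳ (true ∷ p)  (true ∷ q)  = cong suc (weight-splitʳ p q)
weight-splitʳ (true ∷ p)  (false ∷ q) = weight-splitʳ p q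
weight-splitʳ (false ∷ p) (true ∷ q)  = trans (cong suc (weight-splitʳ p q)) (sym (+-suc _ _))
weight-splitʳ (false ∷ p) (false ∷ q) = weight-splitʳ p q

weight-++ : ∀ {L m} (q : Vec Bool L) (s : Vec Bool m) → weight (q ++ᵛ s) ≡ weight q + weight s
weight-++ []          s = refl
weight-++ (true ∷ q)  s = cong suc (weight-++ q s)
weight-++ (false ∷ q) s = weight-++ q s

common-++ : ∀ {L m} (p q : Vec Bool L) (r s : Vec Bool m) →
            common (p ++ᵛ r) (q ++ᵛ s) ≡ common p q + common r s
common-++ []          []          r s = refl
common-++ (true ∷ p)  (true ∷ q)  r s = cong suc (common-++ p q r s)
common-++ (true ∷ p)  (false ∷ q) r s = common-++ p q r s
common-++ (false ∷ p) (_ ∷ q)     r s = common-++ p q r s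

-- pick n k: the number of ways to choose 1 ∸ k elements out of n when k ≤ 1, and 0
-- when k ≥ 2.  A swap moves exactly one 1 and one 0, so a tail has pick a e ways
-- to lose a one when the prefix has already lost e ones.
pick : ℕ → ℕ → ℕ
pick n zero          = n
pick n (suc zero)    = 1
pick n (suc (suc k)) = 0

pick-suc : ∀ n k → pick (suc n) k ≡ pick n (suc k) + pick n k
pick-suc n zero          = refl
pick-suc n (suc zero)    = refl
pick-suc n (suc (suc k)) = refl

-- s completes the swap started by a prefix that lost e ones and gained f ones:
-- r and s share all but one of the e + a ones still needed, and the weight is kept.
completes : ∀ {m} → Vec Bool m → ℕ → ℕ → Vec Bool m → Bool
completes r e f s = (suc (common r s) ≡ᵇ e + weight r) ∧ (f + weight s ≡ᵇ e + weight r)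

tailCount : ∀ {m} → Vec Bool m → ℕ → ℕ → ℕ
tailCount {m} r e f = count (completes r e f) (allVecs m)

tailCount-formula : ∀ {m} (r : Vec Bool m) e f → tailCount r e f ≡ pick (weight r) e * pick (zeros r) f
tailCount-formula []          zero          f             = refl
tailCount-formula []          (suc zero)    zero          = refl
tailCount-formula []          (suc zero)    (suc zero)    = refl
tailCount-formula []          (suc zero)    (suc (suc f)) = refl
tailCount-formula []          (suc (suc e)) f             = refl
tailCount-formula {suc m} (true ∷ r) e f = begin
    tailCount (true ∷ r) e f
  ≡⟨ count-allVecs-suc (completes (true ∷ r) e f) ⟩
    count (completes (true ∷ r) e f ∘ (false ∷_)) (allVecs m)
      + count (completes (true ∷ r) e f ∘ (true ∷_)) (allVecs m)
  ≡⟨ cong₂ _+_ (count-cong loses (allVecs m)) (count-cong keeps (allVecs m)) ⟩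
    tailCount r (suc e) f + tailCount r e f
  ≡⟨ cong₂ _+_ (tailCount-formula r (suc e) f) (tailCount-formula r e f) ⟩
    pick a (suc e) * pick z f + pick a e * pick z f
  ≡⟨ sym (*-distribʳ-+ (pick z f) (pick a (suc e)) (pick a e)) ⟩
    (pick a (suc e) + pick a e) * pick z f
  ≡⟨ cong (_* pick z f) (sym (pick-suc a e)) ⟩
    pick (suc a) e * pick z f ∎
  where
  a z : ℕ
  a = weight r
  z = zeros r
  loses : ∀ s → completes (true ∷ r) e f (false ∷ s) ≡ completes r (suc e) f s
  loses s = cong (λ n → (suc (common r s) ≡ᵇ n) ∧ (f + weight s ≡ᵇ n)) (+-suc e a)
  keeps : ∀ s → completes (true ∷ r) e f (true ∷ s) ≡ completes r e f s
  keeps s = cong₂ (λ n k → (suc (suc (common r s)) ≡ᵇ n) ∧ (k ≡ᵇ n)) (+-suc e a) (+-suc f (weight s))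
tailCount-formula {suc m} (false ∷ r) e f = begin
    tailCount (false ∷ r) e f
  ≡⟨ count-allVecs-suc (completes (false ∷ r) e f) ⟩
    tailCount r e f + count (completes (false ∷ r) e f ∘ (true ∷_)) (allVecs m)
  ≡⟨ cong (tailCount r e f +_) (count-cong gains (allVecs m)) ⟩
    tailCount r e f + tailCount r e (suc f)
  ≡⟨ cong₂ _+_ (tailCount-formula r e f) (tailCount-formula r e (suc f)) ⟩
    pick a e * pick z f + pick a e * pick z (suc f)
  ≡⟨ sym (*-distribˡ-+ (pick a e) (pick z f) (pick z (suc f))) ⟩
    pick a e * (pick z f + pick z (suc f))
  ≡⟨ cong (pick a e *_) (trans (+-comm (pick z f) _) (sym (pick-suc z f))) ⟩
    pick a e * pick (suc z) f ∎
  where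
  a z : ℕ
  a = weight r
  z = zeros r
  gains : ∀ s → completes (false ∷ r) e f (true ∷ s) ≡ completes r e (suc f) s
  gains s = cong (λ k → (suc (common r s) ≡ᵇ e + a) ∧ (k ≡ᵇ e + a)) (+-suc f (weight s))

filters-count : ∀ {n} w (G : Vec Bool n → Bool) (l : List (Vec Bool n)) →
  length (filter (λ y → G y Bool.≟ true) (filter (λ y → weight y ≟ w) l))
    ≡ count (λ y → (weight y ≡ᵇ w) ∧ G y) l
filters-count w G []      = refl
filters-count w G (y ∷ l) with weight y ≡ᵇ w
... | false = filters-count w G l
... | true with G y
...   | true  = cong suc (filters-count w G l)
...   | false = filters-count w G l

neighbours-count : ∀ {n} w (C : Vec Bool n → Bool) (x : Vec Bool n) →
  neighboursIn n w C x ≡ count (λ y → C y ∧ (johnsonAdj w x y ∧ (weight y ≡ᵇ w))) (allVecs n)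
neighbours-count {n} w C x =
  trans (filters-count w (λ y → johnsonAdj w x y ∧ C y) (allVecs n)) (count-cong reorder (allVecs n))
  where
  reorder : ∀ y → ((weight y ≡ᵇ w) ∧ (johnsonAdj w x y ∧ C y)) ≡ (C y ∧ (johnsonAdj w x y ∧ (weight y ≡ᵇ w)))
  reorder y = trans (∧-comm (weight y ≡ᵇ w) _)
                    (trans (cong (_∧ (weight y ≡ᵇ w)) (∧-comm (johnsonAdj w x y) (C y)))
                           (∧-assoc (C y) _ _))

johnsonAdj-≡ᵇ : ∀ {n} v (x y : Vec Bool n) → johnsonAdj (suc v) x y ≡ (common x y ≡ᵇ v)
johnsonAdj-≡ᵇ v x y = isYes≗does (common x y ≟ v)

≡ᵇ-cancelˡ : ∀ c m n → (c + m ≡ᵇ c + n) ≡ (m ≡ᵇ n)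
≡ᵇ-cancelˡ zero    m n = refl
≡ᵇ-cancelˡ (suc c) m n = ≡ᵇ-cancelˡ c m n

adjacent-by-tail : ∀ {L m} (p q : Vec Bool L) (r s : Vec Bool m) v → weight (p ++ᵛ r) ≡ suc v →
  (johnsonAdj (suc v) (p ++ᵛ r) (q ++ᵛ s) ∧ (weight (q ++ᵛ s) ≡ᵇ suc v))
    ≡ completes r (excess p q) (excess q p) s
adjacent-by-tail p q r s v wt = begin
    johnsonAdj (suc v) (p ++ᵛ r) (q ++ᵛ s) ∧ (weight (q ++ᵛ s) ≡ᵇ suc v)
  ≡⟨ cong₂ _∧_ (johnsonAdj-≡ᵇ v (p ++ᵛ r) (q ++ᵛ s)) (cong (_≡ᵇ suc v) (weight-++ q s)) ⟩
    (suc (common (p ++ᵛ r) (q ++ᵛ s)) ≡ᵇ suc v) ∧ (weight q + weight s ≡ᵇ suc v)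
  ≡⟨ cong₂ _∧_ (cong₂ _≡ᵇ_ sharedOnes total) (cong₂ _≡ᵇ_ newWeight total) ⟩
    (c + suc (common r s) ≡ᵇ c + (e + a)) ∧ (c + (f + weight s) ≡ᵇ c + (e + a))
  ≡⟨ cong₂ _∧_ (≡ᵇ-cancelˡ c _ _) (≡ᵇ-cancelˡ c _ _) ⟩
    completes r e f s ∎
  where
  a c e f : ℕ
  a = weight r
  c = common p q
  e = excess p q
  f = excess q p
  total : suc v ≡ c + (e + a)
  total = trans (sym wt) (trans (weight-++ p r) (trans (cong (_+ a) (weight-splitˡ p q)) (+-assoc c e a)))
  sharedOnes : suc (common (p ++ᵛ r) (q ++ᵛ s)) ≡ c + suc (common r s)
  sharedOnes = trans (cong suc (common-++ p q r s)) (sym (+-suc c _))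
  newWeight : weight q + weight s ≡ c + (f + weight s)
  newWeight = trans (cong (_+ weight s) (weight-splitʳ p q)) (+-assoc c f (weight s))

swapSum : ∀ {L} → ℕ → ℕ → Vec Bool L → (Vec Bool L → Bool) → ℕ
swapSum {L} a z p P =
  sum (map (λ q → if P q then pick a (excess p q) * pick z (excess q p) else 0) (allVecs L))

neighbours-by-prefix : ∀ {L m} (p : Vec Bool L) (r : Vec Bool m)
  (P : Vec Bool L → Bool) (C : Vec Bool (L + m) → Bool) → (∀ q s → C (q ++ᵛ s) ≡ P q) →
  ∀ v → weight (p ++ᵛ r) ≡ suc v →
  neighboursIn (L + m) (suc v) C (p ++ᵛ r) ≡ swapSum (weight r) (zeros r) p P
neighbours-by-prefix {L} {m} p r P C C≡P v wt =
  trans (neighbours-count (suc v) C (p ++ᵛ r))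
        (trans (count-prefix L _) (cong sum (map-cong byPrefix (allVecs L))))
  where
  byPrefix : ∀ q →
    count (λ s → C (q ++ᵛ s) ∧ (johnsonAdj (suc v) (p ++ᵛ r) (q ++ᵛ s) ∧ (weight (q ++ᵛ s) ≡ᵇ suc v)))
          (allVecs m)
      ≡ (if P q then pick (weight r) (excess p q) * pick (zeros r) (excess q p) else 0)
  byPrefix q = begin
      _
    ≡⟨ count-cong (λ s → cong₂ _∧_ (C≡P q s) (adjacent-by-tail p q r s v wt)) (allVecs m) ⟩
      count (λ s → P q ∧ completes r (excess p q) (excess q p) s) (allVecs m)
    ≡⟨ count-guard (P q) _ (allVecs m) ⟩
      (if P q then tailCount r (excess p q) (excess q p) else 0)
    ≡⟨ cong (λ n → if P q then n else 0) (tailCount-formula r (excess p q) (excess q p)) ⟩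
      (if P q then pick (weight r) (excess p q) * pick (zeros r) (excess q p) else 0) ∎

record Linear : Set where
  constructor linear
  field
    c₀ c₁ : ℕ

record Quadratic : Set where
  constructor quadratic
  field
    c₀ c₁ c₂ : ℕ

⟦_⟧ₗ : Linear → ℕ → ℕ
⟦ linear c₀ c₁ ⟧ₗ t = c₀ + c₁ * t

⟦_⟧ : Quadratic → ℕ → ℕ
⟦ quadratic c₀ c₁ c₂ ⟧ t = c₀ + c₁ * t + c₂ * (t * t)

𝟘 : Quadratic
𝟘 = quadratic 0 0 0

_⊕_ : Quadratic → Quadratic → Quadratic
quadratic a₀ a₁ a₂ ⊕ quadratic b₀ b₁ b₂ = quadratic (a₀ + b₀) (a₁ + b₁) (a₂ + b₂)

_⊗_ : Linear → Linear → Quadratic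
linear a₀ a₁ ⊗ linear b₀ b₁ = quadratic (a₀ * b₀) (a₀ * b₁ + a₁ * b₀) (a₁ * b₁)

⊕-correct : ∀ P Q t → ⟦ P ⊕ Q ⟧ t ≡ ⟦ P ⟧ t + ⟦ Q ⟧ t
⊕-correct (quadratic a₀ a₁ a₂) (quadratic b₀ b₁ b₂) t = identity a₀ a₁ a₂ b₀ b₁ b₂ t
  where
  identity : ∀ a₀ a₁ a₂ b₀ b₁ b₂ t →
    (a₀ + b₀) + (a₁ + b₁) * t + (a₂ + b₂) * (t * t)
      ≡ (a₀ + a₁ * t + a₂ * (t * t)) + (b₀ + b₁ * t + b₂ * (t * t))
  identity = solve-∀

⊗-correct : ∀ P Q t → ⟦ P ⊗ Q ⟧ t ≡ ⟦ P ⟧ₗ t * ⟦ Q ⟧ₗ t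
⊗-correct (linear a₀ a₁) (linear b₀ b₁) t = identity a₀ a₁ b₀ b₁ t
  where
  identity : ∀ a₀ a₁ b₀ b₁ t →
    a₀ * b₀ + (a₀ * b₁ + a₁ * b₀) * t + a₁ * b₁ * (t * t) ≡ (a₀ + a₁ * t) * (b₀ + b₁ * t)
  identity = solve-∀

pickLinear : ℕ → ℕ → Linear
pickLinear A zero          = linear A 1
pickLinear A (suc zero)    = linear 1 0
pickLinear A (suc (suc k)) = linear 0 0

pickLinear-correct : ∀ A k t → ⟦ pickLinear A k ⟧ₗ t ≡ pick (A + t) k
pickLinear-correct A zero          t = cong (A +_) (*-identityˡ t)
pickLinear-correct A (suc zero)    t = refl
pickLinear-correct A (suc (suc k)) t = refl

swapPoly : ∀ {L} → ℕ → ℕ → Vec Bool L → (Vec Bool L → Bool) → Quadratic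
swapPoly {L} A D p P =
  foldr _⊕_ 𝟘 (map (λ q → if P q then pickLinear A (excess p q) ⊗ pickLinear D (excess q p) else 𝟘)
                    (allVecs L))

swapPoly-correct : ∀ {L} A D (p : Vec Bool L) P t → ⟦ swapPoly A D p P ⟧ t ≡ swapSum (A + t) (D + t) p P
swapPoly-correct {L} A D p P t = sumPoly (allVecs L)
  where
  term : Vec Bool L → Quadratic
  term q = if P q then pickLinear A (excess p q) ⊗ pickLinear D (excess q p) else 𝟘
  termValue : ∀ q → ⟦ term q ⟧ t ≡ (if P q then pick (A + t) (excess p q) * pick (D + t) (excess q p) else 0)
  termValue q with P q
  ... | true  = trans (⊗-correct (pickLinear A (excess p q)) (pickLinear D (excess q p)) t)
                      (cong₂ _*_ (pickLinear-correct A (excess p q) t) (pickLinear-correct D (excess q p) t))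
  ... | false = refl
  sumPoly : ∀ qs → ⟦ foldr _⊕_ 𝟘 (map term qs) ⟧ t
                     ≡ sum (map (λ q → if P q then pick (A + t) (excess p q) * pick (D + t) (excess q p) else 0) qs)
  sumPoly []       = refl
  sumPoly (q ∷ qs) = trans (⊕-correct (term q) _ t) (cong₂ _+_ (termValue q) (sumPoly qs))

balance : ∀ a z c d → a + c ≡ z + d → ∃ λ t → a ≡ (d ∸ c) + t × z ≡ (c ∸ d) + t
balance a z zero    zero    h = a , refl , trans (sym (+-identityʳ z)) (trans (sym h) (+-identityʳ a))
balance a z zero    (suc d) h = z , trans (sym (+-identityʳ a)) (trans h (+-comm z (suc d))) , refl
balance a z (suc c) zero    h = a , refl , trans (sym (+-identityʳ z)) (trans (sym h) (+-comm a (suc c)))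
balance a z (suc c) (suc d) h =
  balance a z c d (suc-injective (trans (sym (+-suc a c)) (trans h (+-suc z d))))

-- For a vertex of J(2w, w) whose 5-bit prefix has k ones, the tail has
-- onesOffset k + t ones and zerosOffset k + t zeros, and w = 3 + (level k + t).
onesOffset : ℕ → ℕ
onesOffset k = 5 ∸ (k + k)

zerosOffset : ℕ → ℕ
zerosOffset k = (k + k) ∸ 5

level : ℕ → ℕ
level k = k + onesOffset k ∸ 3

-- The base weight k + onesOffset k is at least 3, so level k loses nothing.
three≤base : ∀ k → 3 ≤ k + onesOffset k
three≤base zero                = s≤s (s≤s (s≤s z≤n))
three≤base (suc zero)          = s≤s (s≤s (s≤s z≤n))
three≤base (suc (suc zero))    = s≤s (s≤s (s≤s z≤n))
three≤base (suc (suc (suc k))) = s≤s (s≤s (s≤s z≤n))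

parametrise : ∀ k a z m u → k + a ≡ 3 + u → a + z ≡ m → 5 + m ≡ 2 * (3 + u) →
  ∃ λ t → a ≡ onesOffset k + t × z ≡ zerosOffset k + t × u ≡ level k + t
parametrise k a z m u wt len size =
  let (t , a≡ , z≡) = balance a z (k + k) 5 balanced in t , a≡ , z≡ , +-cancelˡ-≡ 3 _ _ (begin
    3 + u                        ≡⟨ sym wt ⟩
    k + a                        ≡⟨ cong (k +_) a≡ ⟩
    k + (onesOffset k + t)       ≡⟨ sym (+-assoc k (onesOffset k) t) ⟩
    (k + onesOffset k) + t       ≡⟨ cong (_+ t) (sym (m+[n∸m]≡n (three≤base k))) ⟩
    3 + (level k + t)            ∎)
  where
  balanced : a + (k + k) ≡ z + 5
  balanced = +-cancelʳ-≡ a _ _ (begin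
    (a + (k + k)) + a   ≡⟨ rearrange₁ a k ⟩
    (k + a) + (k + a)   ≡⟨ cong₂ _+_ wt wt ⟩
    (3 + u) + (3 + u)   ≡⟨ cong ((3 + u) +_) (sym (+-identityʳ (3 + u))) ⟩
    2 * (3 + u)         ≡⟨ sym size ⟩
    5 + m               ≡⟨ cong (5 +_) (sym len) ⟩
    5 + (a + z)         ≡⟨ rearrange₂ a z ⟩
    (z + 5) + a         ∎)
    where
    rearrange₁ : ∀ a k → (a + (k + k)) + a ≡ (k + a) + (k + a)
    rearrange₁ = solve-∀
    rearrange₂ : ∀ a z → 5 + (a + z) ≡ (z + 5) + a
    rearrange₂ = solve-∀

q₁₁ q₁₂ q₂₁ q₂₂ : ℕ → ℕ
q₁₁ w = w * w + 2 ∸ 3 * w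
q₁₂ w = 3 * w ∸ 2
q₂₁ w = w
q₂₂ w = w * w ∸ w

entry₁₁ entry₁₂ entry₂₁ entry₂₂ : ℕ → Quadratic
entry₁₁ V = quadratic ((2 + V) * (1 + V)) (3 + 2 * V) 1
entry₁₂ V = quadratic (7 + 3 * V) 3 0
entry₂₁ V = quadratic (3 + V) 1 0
entry₂₂ V = quadratic ((3 + V) * (2 + V)) (5 + 2 * V) 1

∸-intro : ∀ {n} m k → n ≡ m + k → n ∸ m ≡ k
∸-intro m k eq = trans (cong (_∸ m) eq) (m+n∸m≡n m k)

entry₁₁-correct : ∀ V t → ⟦ entry₁₁ V ⟧ t ≡ q₁₁ (3 + (V + t))
entry₁₁-correct V t = sym (∸-intro (3 * (3 + (V + t))) _ (identity V t))
  where
  identity : ∀ V t → (3 + (V + t)) * (3 + (V + t)) + 2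
                       ≡ 3 * (3 + (V + t)) + ((2 + V) * (1 + V) + (3 + 2 * V) * t + 1 * (t * t))
  identity = solve-∀

entry₁₂-correct : ∀ V t → ⟦ entry₁₂ V ⟧ t ≡ q₁₂ (3 + (V + t))
entry₁₂-correct V t = sym (∸-intro 2 _ (identity V t))
  where
  identity : ∀ V t → 3 * (3 + (V + t)) ≡ 2 + ((7 + 3 * V) + 3 * t + 0 * (t * t))
  identity = solve-∀

entry₂₁-correct : ∀ V t → ⟦ entry₂₁ V ⟧ t ≡ q₂₁ (3 + (V + t))
entry₂₁-correct V t = identity V t
  where
  identity : ∀ V t → (3 + V) + 1 * t + 0 * (t * t) ≡ 3 + (V + t)
  identity = solve-∀

entry₂₂-correct : ∀ V t → ⟦ entry₂₂ V ⟧ t ≡ q₂₂ (3 + (V + t))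
entry₂₂-correct V t = sym (∸-intro (3 + (V + t)) _ (identity V t))
  where
  identity : ∀ V t → (3 + (V + t)) * (3 + (V + t))
                       ≡ (3 + (V + t)) + ((3 + V) * (2 + V) + (5 + 2 * V) * t + 1 * (t * t))
  identity = solve-∀

inB : Vec Bool 5 → Bool
inB p = memB (toList p)

inC1-prefix : ∀ {m} (q : Vec Bool 5) (s : Vec Bool m) → inC1 (q ++ᵛ s) ≡ inB q
inC1-prefix (_ ∷ _ ∷ _ ∷ _ ∷ _ ∷ []) s = refl

cellPolys : Vec Bool 5 → Quadratic × Quadratic
cellPolys p = swapPoly A D p inB , swapPoly A D p (not ∘ inB)
  where
  A D : ℕ
  A = onesOffset (weight p)
  D = zerosOffset (weight p)

quotientRow : Vec Bool 5 → Quadratic × Quadratic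
quotientRow p = if inB p then (entry₁₁ V , entry₁₂ V) else (entry₂₁ V , entry₂₂ V)
  where
  V : ℕ
  V = level (weight p)

-- The heart of the computation: checked for all 32 prefixes by evaluation.
rows-agree : ∀ p → cellPolys p ≡ quotientRow p
rows-agree = All-allVecs (map-≡⇒All (allVecs 5) refl)

vertex-counts : ∀ m u (p : Vec Bool 5) (r : Vec Bool m) → 5 + m ≡ 2 * (3 + u) → weight (p ++ᵛ r) ≡ 3 + u →
  (inB p ≡ true →
     neighboursIn (5 + m) (3 + u) inC1 (p ++ᵛ r) ≡ q₁₁ (3 + u) ×
     neighboursIn (5 + m) (3 + u) (λ y → not (inC1 y)) (p ++ᵛ r) ≡ q₁₂ (3 + u)) ×
  (inB p ≡ false →
     neighboursIn (5 + m) (3 + u) inC1 (p ++ᵛ r) ≡ q₂₁ (3 + u) ×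
     neighboursIn (5 + m) (3 + u) (λ y → not (inC1 y)) (p ++ᵛ r) ≡ q₂₂ (3 + u))
vertex-counts m u p r size wt
  with parametrise (weight p) (weight r) (zeros r) m u (trans (sym (weight-++ p r)) wt) (weight+zeros r) size
... | t , a≡ , z≡ , u≡ =
  (λ p∈B → reads inC1-prefix entry₁₁ q₁₁ entry₁₁-correct (cong proj₁ (row p∈B))
         , reads C₂-prefix entry₁₂ q₁₂ entry₁₂-correct (cong proj₂ (row p∈B))) ,
  (λ p∉B → reads inC1-prefix entry₂₁ q₂₁ entry₂₁-correct (cong proj₁ (row p∉B))
         , reads C₂-prefix entry₂₂ q₂₂ entry₂₂-correct (cong proj₂ (row p∉B)))
  where
  A D V : ℕ
  A = onesOffset (weight p)
  D = zerosOffset (weight p)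
  V = level (weight p)

  C₂-prefix : ∀ q (s : Vec Bool m) → not (inC1 (q ++ᵛ s)) ≡ not (inB q)
  C₂-prefix q s = cong not (inC1-prefix q s)

  row : ∀ {b} → inB p ≡ b →
        cellPolys p ≡ (if b then (entry₁₁ V , entry₁₂ V) else (entry₂₁ V , entry₂₂ V))
  row inB≡ = trans (rows-agree p) (cong (λ b → if b then _ else _) inB≡)

  reads : ∀ {P C} → (∀ q s → C (q ++ᵛ s) ≡ P q) →
          (entry : ℕ → Quadratic) (target : ℕ → ℕ) →
          (∀ V t → ⟦ entry V ⟧ t ≡ target (3 + (V + t))) → swapPoly A D p P ≡ entry V →
          neighboursIn (5 + m) (3 + u) C (p ++ᵛ r) ≡ target (3 + u)
  reads {P} {C} C≡P entry target correct poly≡ = begin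
    neighboursIn (5 + m) (3 + u) C (p ++ᵛ r)  ≡⟨ neighbours-by-prefix p r P C C≡P (2 + u) wt ⟩
    swapSum (weight r) (zeros r) p P         ≡⟨ cong₂ (λ a z → swapSum a z p P) a≡ z≡ ⟩
    swapSum (A + t) (D + t) p P              ≡⟨ sym (swapPoly-correct A D p P t) ⟩
    ⟦ swapPoly A D p P ⟧ t                   ≡⟨ cong (λ E → ⟦ E ⟧ t) poly≡ ⟩
    ⟦ entry V ⟧ t                            ≡⟨ correct V t ⟩
    target (3 + (V + t))                     ≡⟨ cong (λ n → target (3 + n)) (sym u≡) ⟩
    target (3 + u)                           ∎

equitable : ∀ m u → 5 + m ≡ 2 * (3 + u) →
  IsEquitable2 (5 + m) (3 + u) inC1 (q₁₁ (3 + u)) (q₁₂ (3 + u)) (q₂₁ (3 + u)) (q₂₂ (3 + u))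
equitable m u size (x₁ ∷ x₂ ∷ x₃ ∷ x₄ ∷ x₅ ∷ r) = vertex-counts m u (x₁ ∷ x₂ ∷ x₃ ∷ x₄ ∷ x₅ ∷ []) r size

mainTheorem3 : (w : ℕ) → 3 ≤ w →
    IsEquitable2 (2 * w) w inC1 (w * w + 2 ∸ 3 * w) (3 * w ∸ 2) w (w * w ∸ w)
mainTheorem3 (suc (suc (suc u))) (s≤s (s≤s (s≤s _))) =
  subst (λ n → IsEquitable2 n (3 + u) inC1 (q₁₁ (3 + u)) (q₁₂ (3 + u)) (q₂₁ (3 + u)) (q₂₂ (3 + u)))
        (size u) (equitable (u + (1 + u)) u (size u))
  where
  size : ∀ u → 5 + (u + (1 + u)) ≡ 2 * (3 + u)
  size = solve-∀
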